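{- Let $(\mathsf{A}_i)_{i\in\mathbb{N}}$ be a family of downsets of constructive ordinals with $\mathsf{A}_i\subseteq\mathsf{A}_{i+1}$ for all $i$. Then $\mathrm{PredR}_{\bigcup_{i\in\mathbb{N}}\mathsf{A}_i}=\bigcup_{i\in\mathbb{N}}\mathrm{PredR}_{\mathsf{A}_i}$.
   Context: Constructive ordinals: $\Omega$ is the set of infinitary terms generated by $0$, successor $\alpha+1$, and limits $\langle\alpha_i\rangle_{i\in\mathbb{N}}$. $\prec$ is the transitive closure of $\alpha\prec\alpha+1$ and $\alpha_m\prec\langle\alpha_i\rangle_i$; downsets are subsets of $\Omega$ closed downward under $\prec$. $\mathcal{C}_{\mathsf{A}}$ (for a downset $\mathsf{A}$): functions $f(\bar\mu,\bar n;\bar a)$ (ordinal arguments in $\mathsf{A}$, normal numeral arguments $\bar n$, safe numeral arguments $\bar a$, values in $\mathbb{N}$); smallest class containing nullary $0$, projections onto numeral arguments, $s(;a)=a+1$, $P(;0)=0$, $P(;a+1)=a$, $C(;a,b,c)=b$ if $a=0$ else $c$, closed under predicative ordinal recursion ($f(0,\bar\nu,\bar n;\bar a)=g(\bar\nu,\bar n;\bar a)$, $f(\mu+1,\bar\nu,\bar n;\bar a)=h_{suc}(\mu,\bar\nu,\bar n;f(\mu,\bar\nu,\bar n;\bar a),\bar a)$, $f(\langle\mu_i\rangle,\bar\nu,\bar n;\bar a)=h_{lim}(\langle\mu_i\rangle,\bar\nu,\bar n;f(\mu_{q(\bar n;)},\bar\nu,\bar n;\bar a),\bar a)$, $q$ with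 only normal numeral arguments), safe composition $f(\bar\mu,\bar n;\bar a)=h(\bar\mu,\bar s(\bar\mu,\bar n;);\bar t(\bar\mu,\bar n;\bar a))$, substitution of a constant in $\mathsf{A}$ for an ordinal argument, and exchange/weakening/contraction of ordinal arguments. $\mathrm{PredR}_{\mathsf{A}}$: the $f:\mathbb{N}^k\to\mathbb{N}$ with $f(\bar n)=\hat f(\bar n;)$ for some $\hat f\in\mathcal{C}_{\mathsf{A}}$ with no ordinal and no safe arguments. -}

module Defs where

open import Data.Nat using (ℕ; zero; suc)
open import Data.Fin using (Fin)
import Data.Fin as Fin
open import Data.Product using (Σ; ∃; _×_; _,_)
open import Data.Vec.Functional using (Vector; _∷_; [])
open import Relation.Binary.PropositionalEquality using (_≡_)

data Ω : Set where
  oz   : Ω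
  osuc : Ω → Ω
  olim : (ℕ → Ω) → Ω

data _≺_ : Ω → Ω → Set where
  ≺-suc   : ∀ {α} → α ≺ osuc α
  ≺-lim   : ∀ {f} (m : ℕ) → f m ≺ olim f
  ≺-trans : ∀ {α β γ} → α ≺ β → β ≺ γ → α ≺ γ

OrdSet : Set₁
OrdSet = Ω → Set

IsDownset : OrdSet → Set
IsDownset A = ∀ {α β} → β ≺ α → A α → A β

⋃ : (ℕ → OrdSet) → OrdSet
⋃ A α = ∃ λ i → A i α

-- Codes for the class C_A.  Code A k n s : functions with k ordinal,
-- n normal numeral and s safe numeral arguments.
data Code (A : OrdSet) : ℕ → ℕ → ℕ → Set where
  zer   : Code A 0 0 0
  projN : ∀ {n s} → Fin n → Code A 0 n s
  projS : ∀ {n s} → Fin s → Code A 0 n s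
  sucC  : Code A 0 0 1
  predC : Code A 0 0 1
  condC : Code A 0 0 3
  ordrec : ∀ {k n s} →
           (g : Code A k n s) →
           (hsuc : Code A (suc k) n (suc s)) →
           (hlim : Code A (suc k) n (suc s)) →
           (q : Code A 0 n 0) →
           Code A (suc k) n s
  comp  : ∀ {k n s n' s'} →
          (h : Code A k n' s') →
          (ss : Fin n' → Code A k n 0) →
          (ts : Fin s' → Code A k n s) →
          Code A k n s
  const : ∀ {k n s} (α : Ω) → A α → Code A (suc k) n s → Code A k n s
  reidx : ∀ {k k' n s} → (Fin k → Fin k') → Code A k n s → Code A k' n s

mutual
  ⟦_⟧ : ∀ {A k n s} → Code A k n s → Vector Ω k → Vector ℕ n → Vector ℕ s → ℕ
  ⟦ zer ⟧ μ ns as = 0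
  ⟦ projN i ⟧ μ ns as = ns i
  ⟦ projS i ⟧ μ ns as = as i
  ⟦ sucC ⟧ μ ns as = suc (as Fin.zero)
  ⟦ predC ⟧ μ ns as with as Fin.zero
  ... | zero  = 0
  ... | suc a = a
  ⟦ condC ⟧ μ ns as with as Fin.zero
  ... | zero  = as (Fin.suc Fin.zero)
  ... | suc _ = as (Fin.suc (Fin.suc Fin.zero))
  ⟦ ordrec g hs hl q ⟧ μ ns as = rec g hs hl q (λ i → μ (Fin.suc i)) ns as (μ Fin.zero)
  ⟦ comp h ss ts ⟧ μ ns as = ⟦ h ⟧ μ (λ i → ⟦ ss i ⟧ μ ns []) (λ j → ⟦ ts j ⟧ μ ns as)
  ⟦ const α _ c ⟧ μ ns as = ⟦ c ⟧ (α ∷ μ) ns as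
  ⟦ reidx ρ c ⟧ μ ns as = ⟦ c ⟧ (λ i → μ (ρ i)) ns as

  rec : ∀ {A k n s} → Code A k n s → Code A (suc k) n (suc s) →
        Code A (suc k) n (suc s) → Code A 0 n 0 →
        Vector Ω k → Vector ℕ n → Vector ℕ s → Ω → ℕ
  rec g hs hl q ν ns as oz = ⟦ g ⟧ ν ns as
  rec g hs hl q ν ns as (osuc μ) = ⟦ hs ⟧ (μ ∷ ν) ns (rec g hs hl q ν ns as μ ∷ as)
  rec g hs hl q ν ns as (olim μs) =
    ⟦ hl ⟧ (olim μs ∷ ν) ns (rec g hs hl q ν ns as (μs (⟦ q ⟧ [] ns [])) ∷ as)

PredR : OrdSet → (k : ℕ) → (Vector ℕ k → ℕ) → Set
PredR A k f = Σ (Code A 0 k 0) λ c → ∀ ns → f ns ≡ ⟦ c ⟧ [] ns []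

module Submission where

open import Defs
open import Data.Nat using (ℕ; zero; suc; _≤_; _≤′_; ≤′-refl; ≤′-step; _⊔_)
open import Data.Nat.Properties using (≤-refl; ≤-trans; m≤m⊔n; m≤n⊔m; ≤⇒≤′)
open import Data.Fin using (Fin)
import Data.Fin as Fin
open import Data.Product using (∃; _×_; _,_)
open import Data.Unit using (⊤; tt)
open import Data.Vec.Functional using (Vector; _∷_; [])
open import Function using (_∘_; id)
open import Relation.Binary.PropositionalEquality using (_≡_; _≗_; refl; sym; trans; cong)
open import Relation.Unary using (_⊆_)

-- A code only mentions the ordinals of its `const` nodes, finitely many of them. So a code
-- over B whose constants all lie in A can be retyped to a code over A with the same
-- semantics, and a code over ⋃ A has all its constants in a single A m, since the family
-- is increasing.

ConstsIn : ∀ {B k n s} → OrdSet → Code B k n s → Set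
ConstsIn A zer                = ⊤
ConstsIn A (projN _)          = ⊤
ConstsIn A (projS _)          = ⊤
ConstsIn A sucC               = ⊤
ConstsIn A predC              = ⊤
ConstsIn A condC              = ⊤
ConstsIn A (ordrec g hs hl q) = ConstsIn A g × ConstsIn A hs × ConstsIn A hl × ConstsIn A q
ConstsIn A (comp h ss ts)     = ConstsIn A h × (∀ i → ConstsIn A (ss i)) × (∀ j → ConstsIn A (ts j))
ConstsIn A (const α _ c)      = A α × ConstsIn A c
ConstsIn A (reidx _ c)        = ConstsIn A c

constsIn-⊆ : ∀ {A B k n s} → B ⊆ A → (c : Code B k n s) → ConstsIn A c
constsIn-⊆ B⊆A zer                = tt
constsIn-⊆ B⊆A (projN _)          = tt
constsIn-⊆ B⊆A (projS _)          = tt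
constsIn-⊆ B⊆A sucC               = tt
constsIn-⊆ B⊆A predC              = tt
constsIn-⊆ B⊆A condC              = tt
constsIn-⊆ B⊆A (ordrec g hs hl q) =
  constsIn-⊆ B⊆A g , constsIn-⊆ B⊆A hs , constsIn-⊆ B⊆A hl , constsIn-⊆ B⊆A q
constsIn-⊆ B⊆A (comp h ss ts)     =
  constsIn-⊆ B⊆A h , constsIn-⊆ B⊆A ∘ ss , constsIn-⊆ B⊆A ∘ ts
constsIn-⊆ B⊆A (const α α∈B c)    = B⊆A α∈B , constsIn-⊆ B⊆A c
constsIn-⊆ B⊆A (reidx _ c)        = constsIn-⊆ B⊆A c

retype : ∀ {A B k n s} (c : Code B k n s) → ConstsIn A c → Code A k n s
retype zer                _                    = zer
retype (projN i)          _                    = projN i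
retype (projS j)          _                    = projS j
retype sucC               _                    = sucC
retype predC              _                    = predC
retype condC              _                    = condC
retype (ordrec g hs hl q) (pg , phs , phl , pq) =
  ordrec (retype g pg) (retype hs phs) (retype hl phl) (retype q pq)
retype (comp h ss ts)     (ph , pss , pts)     =
  comp (retype h ph) (λ i → retype (ss i) (pss i)) (λ j → retype (ts j) (pts j))
retype (const α _ c)      (α∈A , pc)           = const α α∈A (retype c pc)
retype (reidx ρ c)        pc                   = reidx ρ (retype c pc)

predC-cong : ∀ {A B μ ns ns'} (as as' : Vector ℕ 1) → as Fin.zero ≡ as' Fin.zero →
             ⟦ predC {A} ⟧ μ ns as ≡ ⟦ predC {B} ⟧ μ ns' as'
predC-cong as as' eq with as Fin.zero | as' Fin.zero | eq
... | zero  | _ | refl = refl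
... | suc _ | _ | refl = refl

condC-cong : ∀ {A B μ ns ns'} (as as' : Vector ℕ 3) → as ≗ as' →
             ⟦ condC {A} ⟧ μ ns as ≡ ⟦ condC {B} ⟧ μ ns' as'
condC-cong as as' eq with as Fin.zero | as' Fin.zero | eq Fin.zero
... | zero  | _ | refl = eq _
... | suc _ | _ | refl = eq _

-- Argument vectors are functions, so without extensionality the statement has to allow
-- pointwise equal arguments on the two sides.
mutual
  ⟦retype⟧ : ∀ {A B k n s} (c : Code B k n s) (p : ConstsIn A c) μ {ns ns' as as'} →
             ns ≗ ns' → as ≗ as' → ⟦ retype c p ⟧ μ ns as ≡ ⟦ c ⟧ μ ns' as'
  ⟦retype⟧ zer                p μ ns≗ as≗ = refl
  ⟦retype⟧ (projN i)          p μ ns≗ as≗ = ns≗ i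
  ⟦retype⟧ (projS j)          p μ ns≗ as≗ = as≗ j
  ⟦retype⟧ sucC               p μ ns≗ as≗ = cong suc (as≗ Fin.zero)
  ⟦retype⟧ {A} {B} predC      p μ {ns} {ns'} {as} {as'} ns≗ as≗ =
    predC-cong {A} {B} {μ} {ns} {ns'} as as' (as≗ Fin.zero)
  ⟦retype⟧ {A} {B} condC      p μ {ns} {ns'} {as} {as'} ns≗ as≗ =
    condC-cong {A} {B} {μ} {ns} {ns'} as as' as≗
  ⟦retype⟧ (ordrec g hs hl q) p μ ns≗ as≗ = rec-retype g hs hl q p (μ ∘ Fin.suc) ns≗ as≗ (μ Fin.zero)
  ⟦retype⟧ (comp h ss ts)     (ph , pss , pts) μ ns≗ as≗ =
    ⟦retype⟧ h ph μ (λ i → ⟦retype⟧ (ss i) (pss i) μ ns≗ λ ())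
                    (λ j → ⟦retype⟧ (ts j) (pts j) μ ns≗ as≗)
  ⟦retype⟧ (const α _ c)      (_ , pc) μ ns≗ as≗ = ⟦retype⟧ c pc (α ∷ μ) ns≗ as≗
  ⟦retype⟧ (reidx ρ c)        pc       μ ns≗ as≗ = ⟦retype⟧ c pc (μ ∘ ρ) ns≗ as≗

  rec-retype : ∀ {A B k n s} g hs hl (q : Code B 0 n 0) (p : ConstsIn A (ordrec {k = k} {s = s} g hs hl q))
               ν {ns ns' as as'} → ns ≗ ns' → as ≗ as' → ∀ α →
               let (pg , phs , phl , pq) = p in
               rec (retype g pg) (retype hs phs) (retype hl phl) (retype q pq) ν ns as α
                 ≡ rec g hs hl q ν ns' as' α
  rec-retype g hs hl q (pg , _) ν ns≗ as≗ oz = ⟦retype⟧ g pg ν ns≗ as≗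
  rec-retype g hs hl q p@(_ , phs , _) ν ns≗ as≗ (osuc α) =
    ⟦retype⟧ hs phs (α ∷ ν) ns≗ λ { Fin.zero → rec-retype g hs hl q p ν ns≗ as≗ α
                                  ; (Fin.suc j) → as≗ j }
  -- The two sides pick the branch of the limit through q and its retyped copy.
  rec-retype g hs hl q p@(_ , _ , phl , pq) ν {ns} {ns'} {as' = as'} ns≗ as≗ (olim αs) =
    ⟦retype⟧ hl phl (olim αs ∷ ν) ns≗ λ
      { Fin.zero → trans (rec-retype g hs hl q p ν ns≗ as≗ (αs (⟦ retype q pq ⟧ [] ns [])))
                         (cong (rec g hs hl q ν ns' as' ∘ αs) (⟦retype⟧ q pq [] ns≗ λ ()))
      ; (Fin.suc j) → as≗ j }

PredR-retype : ∀ {A B k f} → ((c , _) : PredR B k f) → ConstsIn A c → PredR A k f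
PredR-retype (c , f≗c) p = retype c p , λ ns → trans (f≗c ns) (sym (⟦retype⟧ c p [] (λ _ → refl) λ ()))

PredR-mono : ∀ {A B k f} → B ⊆ A → PredR B k f → PredR A k f
PredR-mono B⊆A (c , f≗c) = PredR-retype (c , f≗c) (constsIn-⊆ B⊆A c)

Eventually : (ℕ → Set) → Set
Eventually P = ∃ λ m → ∀ {n} → m ≤ n → P n

eventually-⊤ : Eventually (λ _ → ⊤)
eventually-⊤ = 0 , λ _ → tt

eventually-map : ∀ {P Q : ℕ → Set} → (∀ {n} → P n → Q n) → Eventually P → Eventually Q
eventually-map P⇒Q (m , p) = m , P⇒Q ∘ p

eventually-× : ∀ {P Q : ℕ → Set} → Eventually P → Eventually Q → Eventually (λ n → P n × Q n)
eventually-× (m , p) (m' , q) =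
  m ⊔ m' , λ le → p (≤-trans (m≤m⊔n m m') le) , q (≤-trans (m≤n⊔m m m') le)

eventually-∀Fin : ∀ {d} {P : Fin d → ℕ → Set} →
                  (∀ x → Eventually (P x)) → Eventually (λ n → ∀ x → P x n)
eventually-∀Fin {zero}  _  = 0 , λ _ ()
eventually-∀Fin {suc d} ev =
  eventually-map (λ { (p , q) Fin.zero → p ; (p , q) (Fin.suc x) → q x })
                 (eventually-× (ev Fin.zero) (eventually-∀Fin (ev ∘ Fin.suc)))

module Increasing (A : ℕ → OrdSet) (A-step : ∀ i α → A i α → A (suc i) α) where

  ⊆-≤′ : ∀ {i j} → i ≤′ j → A i ⊆ A j
  ⊆-≤′ ≤′-refl       = id
  ⊆-≤′ (≤′-step i≤j) = A-step _ _ ∘ ⊆-≤′ i≤j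

  eventually-constsIn : ∀ {k n s} (c : Code (⋃ A) k n s) → Eventually (λ m → ConstsIn (A m) c)
  eventually-constsIn zer                = eventually-⊤
  eventually-constsIn (projN _)          = eventually-⊤
  eventually-constsIn (projS _)          = eventually-⊤
  eventually-constsIn sucC               = eventually-⊤
  eventually-constsIn predC              = eventually-⊤
  eventually-constsIn condC              = eventually-⊤
  eventually-constsIn (ordrec g hs hl q) =
    eventually-× (eventually-constsIn g) (eventually-× (eventually-constsIn hs)
      (eventually-× (eventually-constsIn hl) (eventually-constsIn q)))
  eventually-constsIn (comp h ss ts)     =
    eventually-× (eventually-constsIn h) (eventually-×
      (eventually-∀Fin (eventually-constsIn ∘ ss)) (eventually-∀Fin (eventually-constsIn ∘ ts)))
  eventually-constsIn (const α (i , α∈Ai) c) =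
    eventually-× (i , λ i≤m → ⊆-≤′ (≤⇒≤′ i≤m) α∈Ai) (eventually-constsIn c)
  eventually-constsIn (reidx _ c)        = eventually-constsIn c

  PredR-⋃ : ∀ {k f} → PredR (⋃ A) k f → ∃ λ m → PredR (A m) k f
  PredR-⋃ (c , f≗c) = let m , constsIn = eventually-constsIn c in
    m , PredR-retype (c , f≗c) (constsIn ≤-refl)

lemma5p13 : (A : ℕ → OrdSet) →
            (∀ i → IsDownset (A i)) →
            (∀ i α → A i α → A (suc i) α) →
            (k : ℕ) (f : Vector ℕ k → ℕ) →
            (PredR (⋃ A) k f → ∃ λ i → PredR (A i) k f)
            × ((∃ λ i → PredR (A i) k f) → PredR (⋃ A) k f)
lemma5p13 A _ A-step k f =
  Increasing.PredR-⋃ A A-step , λ (i , p) → PredR-mono (i ,_) p
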